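{- Let $m$ be a prime, $i\in\{1,2,\ldots,m-1\}$, and $\mathcal{M}=(m^{n-1})_{n\in\mathbb{N}_+}$. Then for every integer $k\geqslant 2$, \[ \lim_{N\to\infty}\frac{\#\{n\leqslant N:\ p_\mathcal{M}(n,k)\equiv i\pmod{m}\}}{N}=\frac{(m-1)^{k-2}}{m^{k-1}}. \]
   Context: $\mathbb{N}=\{0,1,2,\ldots\}$ and $n$ ranges over $\mathbb{N}$. $p_\mathcal{M}(n,k)$ is the number of tuples $(x_1,\ldots,x_k)\in\mathbb{N}^k$ with $x_1+mx_2+\cdots+m^{k-1}x_k=n$, i.e. $\sum_{n\ge0}p_\mathcal{M}(n,k)x^n=\prod_{i=0}^{k-1}(1-x^{m^i})^{ -1}$. -}

module Defs where

open import Data.Nat using (ℕ; zero; suc; _+_; _*_; _^_; _≤_; _<_; _≟_; _%_; NonZero)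
open import Data.Nat.Properties using (≤-pred)
open import Data.List using (List; []; _∷_; length; filter; concatMap; upTo; map)
open import Data.Vec using (Vec; []; _∷_)
open import Data.Integer using (+_)
open import Data.Rational using (ℚ; _/_; 0ℚ)
open import Relation.Binary.PropositionalEquality using (_≡_)

vecsUpTo : (k b : ℕ) → List (Vec ℕ k)
vecsUpTo zero    b = [] ∷ []
vecsUpTo (suc k) b = concatMap (λ x → map (x ∷_) (vecsUpTo k b)) (upTo (suc b))

weighted : (m : ℕ) → {k : ℕ} → Vec ℕ k → ℕ
weighted m []       = 0
weighted m (x ∷ xs) = x + m * weighted m xs

-- p_M(n,k) for M = (m^{j-1})_{j≥1}: the number of (x₁,…,x_k) ∈ ℕ^k with
-- x₁ + m x₂ + ⋯ + m^{k-1} x_k = n.  Any such tuple (m ≥ 1) has every xⱼ ≤ n,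
-- so enumerating tuples with entries ≤ n counts all of them.
pM : (m n k : ℕ) → ℕ
pM m n k = length (filter (λ v → weighted m v ≟ n) (vecsUpTo k n))

-- #{ n ≤ N : p_M(n,k) ≡ i (mod m) }   (n ranges over 0,…,N)
countRes : (m k i N : ℕ) → .{{NonZero m}} → ℕ
countRes m k i N = length (filter (λ n → (pM m n k % m) ≟ (i % m)) (upTo (suc N)))

-- a / d as a rational (only used with d ≠ 0; returns 0 for d = 0)
_/ℕ_ : ℕ → ℕ → ℚ
a /ℕ zero  = 0ℚ
a /ℕ suc d = (+ a) / suc d

{-# OPTIONS --safe #-}
-- Splitting off the first coordinate, p_M(n, k) is the number of (k − 1)-tuples of weight at most
-- ⌊n/m⌋, and counting tuples of weight ≤ a by their first coordinate shows that, modulo m, their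
-- number is (a mod m + 1) times the number for ⌊a/m⌋.  Hence p_M(n, k) ≡ ∏ (dⱼ + 1) (mod m), the
-- product over the base-m digits d₁, …, d_{k−1} of n (all but the lowest one), which has period m^k
-- in n.  For m prime and i ≢ 0, as d runs through 0, …, m − 1 the product (d + 1)·g hits i exactly
-- once if m ∤ g and never if m ∣ g, while (d + 1)·g stays prime to m for exactly m − 1 values of d
-- when m ∤ g.  So a period contains m (m − 1)^{k−2} solutions of p_M(n, k) ≡ i, and periodicity
-- gives the density (m − 1)^{k−2} / m^{k−1}.
module Submission where

open import Defs
open import Data.Nat hiding (∣_-_∣)
open import Data.Nat.Properties
open import Data.Nat.DivMod
open import Data.Nat.Divisibility
open import Data.Nat.Primality using (Prime; euclidsLemma; prime⇒irreducible; prime⇒nonTrivial)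
open import Data.Nat.Coprimality using (Coprime; coprime-Bézout)
open import Data.Nat.GCD using (module Bézout)
open import Data.Product using (∃-syntax; _×_; _,_; proj₁; proj₂)
open import Data.Sum using (inj₁; inj₂)
open import Data.Integer as ℤ using (-[1+_]; +[1+_]; _⊖_)
import Data.Integer.Properties as ℤP
open import Data.Rational as ℚ using (ℚ; mkℚ; 0ℚ; toℚᵘ; ∣_∣; _-_) renaming (_<_ to _<ℚ_)
import Data.Rational.Properties as ℚP
open import Data.Rational.Unnormalised as ℚᵘ using (mkℚᵘ)
import Data.Rational.Unnormalised.Properties as ℚᵘP
open import Data.List using (List; []; _∷_; _++_; length; filter; map; concatMap; applyUpTo; upTo)
open import Data.Vec using (Vec; _∷_)
open import Function using (_∘_)
open import Level using (Level)
open import Relation.Nullary using (Dec; yes; no; ¬_; ¬?)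
open import Relation.Unary using (Pred; Decidable)
open import Relation.Binary.PropositionalEquality
open import Data.Empty using (⊥-elim)
open import Data.Nat.Tactic.RingSolver using (solve-∀)

private
  variable
    a b p : Level
    A : Set a
    B : Set b

𝟙 : Dec A → ℕ
𝟙 (yes _) = 1
𝟙 (no _)  = 0

𝟙-yes : (d : Dec A) → A → 𝟙 d ≡ 1
𝟙-yes (yes _) _ = refl
𝟙-yes (no ¬a) a = ⊥-elim (¬a a)

𝟙-no : (d : Dec A) → ¬ A → 𝟙 d ≡ 0
𝟙-no (yes a) ¬a = ⊥-elim (¬a a)
𝟙-no (no _)  _  = refl

𝟙-cong : (d : Dec A) (e : Dec B) → (A → B) → (B → A) → 𝟙 d ≡ 𝟙 e
𝟙-cong (yes a) e f g = sym (𝟙-yes e (f a))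
𝟙-cong (no ¬a) e f g = sym (𝟙-no e (¬a ∘ g))

𝟙≤1 : (d : Dec A) → 𝟙 d ≤ 1
𝟙≤1 (yes _) = ≤-refl
𝟙≤1 (no _)  = z≤n

𝟙-¬?+𝟙 : (d : Dec A) → 𝟙 (¬? d) + 𝟙 d ≡ 1
𝟙-¬?+𝟙 (yes _) = refl
𝟙-¬?+𝟙 (no _)  = refl

∑< : ℕ → (ℕ → ℕ) → ℕ
∑< zero    f = 0
∑< (suc n) f = f 0 + ∑< n (f ∘ suc)

syntax ∑< n (λ x → e) = ∑[ x < n ] e

∑<-cong : ∀ n {f g : ℕ → ℕ} → (∀ x → x < n → f x ≡ g x) → ∑[ x < n ] f x ≡ ∑[ x < n ] g x
∑<-cong zero    eq = refl
∑<-cong (suc n) eq = cong₂ _+_ (eq 0 z<s) (∑<-cong n (λ x x<n → eq (suc x) (s<s x<n)))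

∑<-const : ∀ n c → ∑[ x < n ] c ≡ n * c
∑<-const zero    c = refl
∑<-const (suc n) c = cong (c +_) (∑<-const n c)

∑<-zero : ∀ n {f : ℕ → ℕ} → (∀ x → x < n → f x ≡ 0) → ∑[ x < n ] f x ≡ 0
∑<-zero n eq = trans (∑<-cong n eq) (trans (∑<-const n 0) (*-zeroʳ n))

∑<-split : ∀ k n (f : ℕ → ℕ) → ∑[ x < k + n ] f x ≡ ∑[ x < k ] f x + ∑[ x < n ] f (k + x)
∑<-split zero    n f = refl
∑<-split (suc k) n f = trans (cong (f 0 +_) (∑<-split k n (f ∘ suc))) (sym (+-assoc (f 0) _ _))

∑<-suc : ∀ n (f : ℕ → ℕ) → ∑[ x < suc n ] f x ≡ ∑[ x < n ] f x + f n
∑<-suc zero    f = +-identityʳ (f 0)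
∑<-suc (suc n) f = trans (cong (f 0 +_) (∑<-suc n (f ∘ suc))) (sym (+-assoc (f 0) _ _))

∑<-distrib-+ : ∀ n (f g : ℕ → ℕ) → ∑[ x < n ] (f x + g x) ≡ ∑[ x < n ] f x + ∑[ x < n ] g x
∑<-distrib-+ zero    f g = refl
∑<-distrib-+ (suc n) f g = begin
  f 0 + g 0 + ∑[ x < n ] (f (suc x) + g (suc x))
    ≡⟨ cong (f 0 + g 0 +_) (∑<-distrib-+ n (f ∘ suc) (g ∘ suc)) ⟩
  f 0 + g 0 + (∑[ x < n ] f (suc x) + ∑[ x < n ] g (suc x))
    ≡⟨ +-+-comm (f 0) (g 0) _ _ ⟩
  f 0 + ∑[ x < n ] f (suc x) + (g 0 + ∑[ x < n ] g (suc x)) ∎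
  where
  open ≡-Reasoning
  +-+-comm : ∀ a b c d → a + b + (c + d) ≡ a + c + (b + d)
  +-+-comm = solve-∀

∑<-distribˡ-* : ∀ n c (f : ℕ → ℕ) → ∑[ x < n ] (c * f x) ≡ c * ∑[ x < n ] f x
∑<-distribˡ-* zero    c f = sym (*-zeroʳ c)
∑<-distribˡ-* (suc n) c f =
  trans (cong (c * f 0 +_) (∑<-distribˡ-* n c (f ∘ suc))) (sym (*-distribˡ-+ c (f 0) _))

∑<-≤ : ∀ n {f : ℕ → ℕ} → (∀ x → f x ≤ 1) → ∑[ x < n ] f x ≤ n
∑<-≤ zero    f≤1 = z≤n
∑<-≤ (suc n) f≤1 = +-mono-≤ (f≤1 0) (∑<-≤ n (f≤1 ∘ suc))

∑<-blocks : ∀ k n (f : ℕ → ℕ) → ∑[ x < k * n ] f x ≡ ∑[ q < k ] ∑[ r < n ] f (q * n + r)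
∑<-blocks zero    n f = refl
∑<-blocks (suc k) n f = begin
  ∑[ x < n + k * n ] f x
    ≡⟨ ∑<-split n (k * n) f ⟩
  ∑[ r < n ] f r + ∑[ x < k * n ] f (n + x)
    ≡⟨ cong (∑[ r < n ] f r +_) (∑<-blocks k n (λ x → f (n + x))) ⟩
  ∑[ r < n ] f r + ∑[ q < k ] ∑[ r < n ] f (n + (q * n + r))
    ≡⟨ cong (∑[ r < n ] f r +_) (∑<-cong k (λ q _ → ∑<-cong n (λ r _ → cong f (sym (+-assoc n (q * n) r))))) ⟩
  ∑[ r < n ] f (0 * n + r) + ∑[ q < k ] ∑[ r < n ] f (suc q * n + r) ∎
  where open ≡-Reasoning

∑<-periodic : ∀ n (f : ℕ → ℕ) → (∀ x → f (n + x) ≡ f x) →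
              ∀ k → ∑[ x < k * n ] f x ≡ k * ∑[ x < n ] f x
∑<-periodic n f per zero    = refl
∑<-periodic n f per (suc k) = begin
  ∑[ x < n + k * n ] f x                    ≡⟨ ∑<-split n (k * n) f ⟩
  ∑[ x < n ] f x + ∑[ x < k * n ] f (n + x) ≡⟨ cong (∑[ x < n ] f x +_) (∑<-cong (k * n) (λ x _ → per x)) ⟩
  ∑[ x < n ] f x + ∑[ x < k * n ] f x       ≡⟨ cong (∑[ x < n ] f x +_) (∑<-periodic n f per k) ⟩
  ∑[ x < n ] f x + k * ∑[ x < n ] f x       ∎
  where open ≡-Reasoning

∑<-𝟙≟ : ∀ n y → ∑[ x < n ] 𝟙 (x ≟ y) ≡ 𝟙 (y <? n)
∑<-𝟙≟ zero    y       = refl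
∑<-𝟙≟ (suc n) zero    = cong suc (∑<-zero n (λ x _ → refl))
∑<-𝟙≟ (suc n) (suc y) = begin
  ∑[ x < n ] 𝟙 (suc x ≟ suc y)
    ≡⟨ ∑<-cong n (λ x _ → 𝟙-cong (suc x ≟ suc y) (x ≟ y) suc-injective (cong suc)) ⟩
  ∑[ x < n ] 𝟙 (x ≟ y)         ≡⟨ ∑<-𝟙≟ n y ⟩
  𝟙 (y <? n)                   ≡⟨ 𝟙-cong (y <? n) (suc y <? suc n) s<s s<s⁻¹ ⟩
  𝟙 (suc y <? suc n)           ∎
  where open ≡-Reasoning

∑<-𝟙-unique : ∀ n {P : Pred ℕ p} (P? : Decidable P) {y} → y < n → P y →
              (∀ x → x < n → P x → x ≡ y) → ∑[ x < n ] 𝟙 (P? x) ≡ 1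
∑<-𝟙-unique n P? {y} y<n Py unique = begin
  ∑[ x < n ] 𝟙 (P? x)   ≡⟨ ∑<-cong n (λ x x<n → 𝟙-cong (P? x) (x ≟ y) (unique x x<n) (λ { refl → Py })) ⟩
  ∑[ x < n ] 𝟙 (x ≟ y)  ≡⟨ ∑<-𝟙≟ n y ⟩
  𝟙 (y <? n)            ≡⟨ 𝟙-yes (y <? n) y<n ⟩
  1                     ∎
  where open ≡-Reasoning

∑<-𝟙≤ : ∀ n y → y < n → ∑[ x < n ] 𝟙 (x ≤? y) ≡ suc y
∑<-𝟙≤ (suc n) zero    _       = cong suc (∑<-zero n (λ x _ → refl))
∑<-𝟙≤ (suc n) (suc y) (s<s y<n) = cong suc (begin
  ∑[ x < n ] 𝟙 (suc x ≤? suc y) ≡⟨ ∑<-cong n (λ x _ → 𝟙-cong (suc x ≤? suc y) (x ≤? y) s≤s⁻¹ s≤s) ⟩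
  ∑[ x < n ] 𝟙 (x ≤? y)         ≡⟨ ∑<-𝟙≤ n y y<n ⟩
  suc y                         ∎)
  where open ≡-Reasoning

∑<-rotate : ∀ n (f : ℕ → ℕ) → f n ≡ f 0 → ∑[ x < n ] f (suc x) ≡ ∑[ x < n ] f x
∑<-rotate n f fn≡f0 = +-cancelʳ-≡ (f n) _ _ (begin
  ∑[ x < n ] f (suc x) + f n  ≡⟨ +-comm _ (f n) ⟩
  f n + ∑[ x < n ] f (suc x)  ≡⟨ cong (_+ ∑[ x < n ] f (suc x)) fn≡f0 ⟩
  ∑[ x < suc n ] f x          ≡⟨ ∑<-suc n f ⟩
  ∑[ x < n ] f x + f n        ∎)
  where open ≡-Reasoning

∑<-𝟙-¬? : ∀ n {P : Pred ℕ p} (P? : Decidable P) → ∑[ x < n ] 𝟙 (¬? (P? x)) ≡ n ∸ ∑[ x < n ] 𝟙 (P? x)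
∑<-𝟙-¬? n P? = begin
  ∑[ x < n ] 𝟙 (¬? (P? x))                     ≡⟨ m+n∸n≡m _ hits ⟨
  ∑[ x < n ] 𝟙 (¬? (P? x)) + hits ∸ hits        ≡⟨ cong (_∸ hits) (∑<-distrib-+ n _ (λ x → 𝟙 (P? x))) ⟨
  ∑[ x < n ] (𝟙 (¬? (P? x)) + 𝟙 (P? x)) ∸ hits ≡⟨ cong (_∸ hits) (∑<-cong n (λ x _ → 𝟙-¬?+𝟙 (P? x))) ⟩
  ∑[ x < n ] 1 ∸ hits                           ≡⟨ cong (_∸ hits) (trans (∑<-const n 1) (*-identityʳ n)) ⟩
  n ∸ hits                                      ∎
  where
  open ≡-Reasoning
  hits : ℕ
  hits = ∑[ x < n ] 𝟙 (P? x)

∑<-𝟙+≟ : ∀ c n → ∑[ x < suc n ] 𝟙 (x + c ≟ n) ≡ 𝟙 (c ≤? n)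
∑<-𝟙+≟ c n with c ≤? n
... | yes c≤n = begin
  ∑[ x < suc n ] 𝟙 (x + c ≟ n)  ≡⟨ ∑<-cong (suc n) (λ x _ → 𝟙-cong (x + c ≟ n) (x ≟ n ∸ c) to from) ⟩
  ∑[ x < suc n ] 𝟙 (x ≟ n ∸ c)  ≡⟨ ∑<-𝟙≟ (suc n) (n ∸ c) ⟩
  𝟙 (n ∸ c <? suc n)            ≡⟨ 𝟙-yes (n ∸ c <? suc n) (s≤s (m∸n≤m n c)) ⟩
  1                             ∎
  where
  open ≡-Reasoning
  to : ∀ {x} → x + c ≡ n → x ≡ n ∸ c
  to {x} eq = trans (sym (m+n∸n≡m x c)) (cong (_∸ c) eq)
  from : ∀ {x} → x ≡ n ∸ c → x + c ≡ n
  from refl = m∸n+n≡m c≤n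
... | no c≰n = ∑<-zero (suc n) (λ x _ → 𝟙-no (x + c ≟ n) (λ eq → c≰n (subst (c ≤_) eq (m≤n+m c x))))

∑<-𝟙+≤ : ∀ c a n → a < n → ∑[ x < n ] 𝟙 (x + c ≤? a) ≡ 𝟙 (c ≤? a) * suc (a ∸ c)
∑<-𝟙+≤ c a n a<n with c ≤? a
... | yes c≤a = begin
  ∑[ x < n ] 𝟙 (x + c ≤? a)  ≡⟨ ∑<-cong n (λ x _ → 𝟙-cong (x + c ≤? a) (x ≤? a ∸ c) to from) ⟩
  ∑[ x < n ] 𝟙 (x ≤? a ∸ c)  ≡⟨ ∑<-𝟙≤ n (a ∸ c) (≤-<-trans (m∸n≤m a c) a<n) ⟩
  suc (a ∸ c)                ≡⟨ +-identityʳ _ ⟨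
  1 * suc (a ∸ c)            ∎
  where
  open ≡-Reasoning
  to : ∀ {x} → x + c ≤ a → x ≤ a ∸ c
  to {x} le = subst (_≤ a ∸ c) (m+n∸n≡m x c) (∸-monoˡ-≤ c le)
  from : ∀ {x} → x ≤ a ∸ c → x + c ≤ a
  from le = subst (_ ≤_) (m∸n+n≡m c≤a) (+-monoˡ-≤ c le)
... | no c≰a = ∑<-zero n (λ x _ → 𝟙-no (x + c ≤? a) (λ le → c≰a (≤-trans (m≤n+m c x) le)))

-- L = t P + r consists of t periods, each summing to A, and a remainder contributing e.
periodic-bounds : ∀ t A e r C D P → A * D ≡ C * P → e ≤ P → r ≤ P →
  (t * A + e) * D ≤ C * (t * P + r) + (C + D) * P × C * (t * P + r) ≤ (t * A + e) * D + (C + D) * P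
periodic-bounds t A e r C D P AD≡CP e≤P r≤P = lower , upper
  where
  open ≤-Reasoning
  lower : (t * A + e) * D ≤ C * (t * P + r) + (C + D) * P
  lower = begin
    (t * A + e) * D                        ≡⟨ expand₁ t A e D ⟩
    t * (A * D) + e * D                    ≡⟨ cong (λ z → t * z + e * D) AD≡CP ⟩
    t * (C * P) + e * D                    ≤⟨ +-monoʳ-≤ (t * (C * P)) (*-monoˡ-≤ D e≤P) ⟩
    t * (C * P) + P * D                    ≤⟨ m≤m+n _ (C * r + C * P) ⟩
    t * (C * P) + P * D + (C * r + C * P)  ≡⟨ expand₂ t C P D r ⟩
    C * (t * P + r) + (C + D) * P          ∎
    where
    expand₁ : ∀ t A e D → (t * A + e) * D ≡ t * (A * D) + e * D
    expand₁ = solve-∀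
    expand₂ : ∀ t C P D r → t * (C * P) + P * D + (C * r + C * P) ≡ C * (t * P + r) + (C + D) * P
    expand₂ = solve-∀
  upper : C * (t * P + r) ≤ (t * A + e) * D + (C + D) * P
  upper = begin
    C * (t * P + r)                        ≡⟨ expand₁ C t P r ⟩
    t * (C * P) + C * r                    ≤⟨ +-monoʳ-≤ (t * (C * P)) (*-monoʳ-≤ C r≤P) ⟩
    t * (C * P) + C * P                    ≤⟨ m≤m+n _ (e * D + D * P) ⟩
    t * (C * P) + C * P + (e * D + D * P)  ≡⟨ cong (λ z → t * z + C * P + (e * D + D * P)) AD≡CP ⟨
    t * (A * D) + C * P + (e * D + D * P)  ≡⟨ expand₂ t A D C P e ⟩
    (t * A + e) * D + (C + D) * P          ∎
    where
    expand₁ : ∀ C t P r → C * (t * P + r) ≡ t * (C * P) + C * r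
    expand₁ = solve-∀
    expand₂ : ∀ t A D C P e → t * (A * D) + C * P + (e * D + D * P) ≡ (t * A + e) * D + (C + D) * P
    expand₂ = solve-∀

∑<-periodic-density : ∀ P .{{_ : NonZero P}} (f : ℕ → ℕ) → (∀ x → f x ≤ 1) → (∀ x → f (P + x) ≡ f x) →
  ∀ C D → ∑[ x < P ] f x * D ≡ C * P → ∀ L →
  ∑[ x < L ] f x * D ≤ C * L + (C + D) * P × C * L ≤ ∑[ x < L ] f x * D + (C + D) * P
∑<-periodic-density P f f≤1 periodic C D density L =
  subst₂ (λ c n → c * D ≤ C * n + (C + D) * P × C * n ≤ c * D + (C + D) * P) (sym ∑≡) (sym L≡)
         (periodic-bounds t (∑[ x < P ] f x) e r C D P density e≤P (m%n≤n L P))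
  where
  t r e : ℕ
  t = L / P
  r = L % P
  e = ∑[ x < r ] f (t * P + x)
  L≡ : L ≡ t * P + r
  L≡ = trans (m≡m%n+[m/n]*n L P) (+-comm r (t * P))
  ∑≡ : ∑[ x < L ] f x ≡ t * ∑[ x < P ] f x + e
  ∑≡ = begin
    ∑[ x < L ] f x                   ≡⟨ cong (λ n → ∑[ x < n ] f x) L≡ ⟩
    ∑[ x < t * P + r ] f x           ≡⟨ ∑<-split (t * P) r f ⟩
    ∑[ x < t * P ] f x + e           ≡⟨ cong (_+ e) (∑<-periodic P f periodic t) ⟩
    t * ∑[ x < P ] f x + e           ∎
    where open ≡-Reasoning
  e≤P : e ≤ P
  e≤P = ≤-trans (∑<-≤ r (f≤1 ∘ (t * P +_))) (m%n≤n L P)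

∑∈ : List A → (A → ℕ) → ℕ
∑∈ []       f = 0
∑∈ (x ∷ xs) f = f x + ∑∈ xs f

syntax ∑∈ xs (λ x → e) = ∑[ x ∈ xs ] e

length-filter≡∑𝟙 : {P : Pred A p} (P? : Decidable P) (xs : List A) →
                   length (filter P? xs) ≡ ∑[ x ∈ xs ] 𝟙 (P? x)
length-filter≡∑𝟙 P? []       = refl
length-filter≡∑𝟙 P? (x ∷ xs) with P? x
... | yes _ = cong suc (length-filter≡∑𝟙 P? xs)
... | no  _ = length-filter≡∑𝟙 P? xs

∑∈-cong : (xs : List A) {f g : A → ℕ} → (∀ x → f x ≡ g x) → ∑[ x ∈ xs ] f x ≡ ∑[ x ∈ xs ] g x
∑∈-cong []       eq = refl
∑∈-cong (x ∷ xs) eq = cong₂ _+_ (eq x) (∑∈-cong xs eq)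

∑∈-++ : (xs ys : List A) (f : A → ℕ) → ∑[ x ∈ xs ++ ys ] f x ≡ ∑[ x ∈ xs ] f x + ∑[ x ∈ ys ] f x
∑∈-++ []       ys f = refl
∑∈-++ (x ∷ xs) ys f = trans (cong (f x +_) (∑∈-++ xs ys f)) (sym (+-assoc (f x) _ _))

∑∈-concatMap : (g : A → List B) (xs : List A) (f : B → ℕ) →
               ∑[ y ∈ concatMap g xs ] f y ≡ ∑[ x ∈ xs ] ∑[ y ∈ g x ] f y
∑∈-concatMap g []       f = refl
∑∈-concatMap g (x ∷ xs) f =
  trans (∑∈-++ (g x) (concatMap g xs) f) (cong (∑[ y ∈ g x ] f y +_) (∑∈-concatMap g xs f))

∑∈-map : (g : A → B) (xs : List A) (f : B → ℕ) → ∑[ y ∈ map g xs ] f y ≡ ∑[ x ∈ xs ] f (g x)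
∑∈-map g []       f = refl
∑∈-map g (x ∷ xs) f = cong (f (g x) +_) (∑∈-map g xs f)

∑∈-applyUpTo : (g : ℕ → A) (n : ℕ) (f : A → ℕ) → ∑[ y ∈ applyUpTo g n ] f y ≡ ∑[ x < n ] f (g x)
∑∈-applyUpTo g zero    f = refl
∑∈-applyUpTo g (suc n) f = cong (f (g 0) +_) (∑∈-applyUpTo (g ∘ suc) n f)

∑∈-distrib-+ : (xs : List A) (f g : A → ℕ) → ∑[ x ∈ xs ] (f x + g x) ≡ ∑[ x ∈ xs ] f x + ∑[ x ∈ xs ] g x
∑∈-distrib-+ []       f g = refl
∑∈-distrib-+ (x ∷ xs) f g =
  trans (cong (f x + g x +_) (∑∈-distrib-+ xs f g)) (+-+-comm (f x) (g x) _ _)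
  where
  +-+-comm : ∀ a b c d → a + b + (c + d) ≡ a + c + (b + d)
  +-+-comm = solve-∀

∑∈-distribˡ-* : (xs : List A) (c : ℕ) (f : A → ℕ) → ∑[ x ∈ xs ] (c * f x) ≡ c * ∑[ x ∈ xs ] f x
∑∈-distribˡ-* []       c f = sym (*-zeroʳ c)
∑∈-distribˡ-* (x ∷ xs) c f =
  trans (cong (c * f x +_) (∑∈-distribˡ-* xs c f)) (sym (*-distribˡ-+ c (f x) _))

∑<-∑∈-comm : ∀ n (xs : List A) (h : ℕ → A → ℕ) →
             ∑[ i < n ] ∑[ x ∈ xs ] h i x ≡ ∑[ x ∈ xs ] ∑[ i < n ] h i x
∑<-∑∈-comm n []       h = ∑<-zero n (λ _ _ → refl)
∑<-∑∈-comm n (x ∷ xs) h =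
  trans (∑<-distrib-+ n (λ i → h i x) (λ i → ∑[ y ∈ xs ] h i y))
        (cong (∑[ i < n ] h i x +_) (∑<-∑∈-comm n xs h))

∑-vecsUpTo-suc : ∀ k b (f : Vec ℕ (suc k) → ℕ) →
                 ∑[ v ∈ vecsUpTo (suc k) b ] f v ≡ ∑[ v ∈ vecsUpTo k b ] ∑[ x < suc b ] f (x ∷ v)
∑-vecsUpTo-suc k b f = begin
  ∑[ v ∈ concatMap row (upTo (suc b)) ] f v     ≡⟨ ∑∈-concatMap row (upTo (suc b)) f ⟩
  ∑[ x ∈ upTo (suc b) ] ∑[ v ∈ row x ] f v      ≡⟨ ∑∈-cong (upTo (suc b)) (λ x → ∑∈-map (x ∷_) (vecsUpTo k b) f) ⟩
  ∑[ x ∈ upTo (suc b) ] ∑[ v ∈ vecsUpTo k b ] f (x ∷ v)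
    ≡⟨ ∑∈-applyUpTo (λ x → x) (suc b) (λ x → ∑[ v ∈ vecsUpTo k b ] f (x ∷ v)) ⟩
  ∑[ x < suc b ] ∑[ v ∈ vecsUpTo k b ] f (x ∷ v) ≡⟨ ∑<-∑∈-comm (suc b) (vecsUpTo k b) (λ x v → f (x ∷ v)) ⟩
  ∑[ v ∈ vecsUpTo k b ] ∑[ x < suc b ] f (x ∷ v) ∎
  where
  open ≡-Reasoning
  row : ℕ → List (Vec ℕ (suc k))
  row x = map (x ∷_) (vecsUpTo k b)

module _ (m : ℕ) .{{_ : NonZero m}} where

  digitProduct : ℕ → ℕ → ℕ
  digitProduct zero    a = 1
  digitProduct (suc k) a = suc (a % m) * digitProduct k (a / m)

  #weighted≤ : ℕ → ℕ → ℕ → ℕ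
  #weighted≤ k b a = ∑[ v ∈ vecsUpTo k b ] 𝟙 (weighted m v ≤? a)

  %≡⇒∣∸ : ∀ x y → x % m ≡ y % m → m ∣ y ∸ x
  %≡⇒∣∸ x y eq = divides (y / m ∸ x / m) (begin
    y ∸ x                                       ≡⟨ cong₂ _∸_ (m≡m%n+[m/n]*n y m) (m≡m%n+[m/n]*n x m) ⟩
    y % m + y / m * m ∸ (x % m + x / m * m)     ≡⟨ cong (λ t → y % m + y / m * m ∸ (t + x / m * m)) eq ⟩
    y % m + y / m * m ∸ (y % m + x / m * m)     ≡⟨ [m+n]∸[m+o]≡n∸o (y % m) _ _ ⟩
    y / m * m ∸ x / m * m                       ≡⟨ *-distribʳ-∸ m (y / m) (x / m) ⟨
    (y / m ∸ x / m) * m                         ∎)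
    where open ≡-Reasoning

  %-congʳ-* : ∀ c {x y} → x % m ≡ y % m → (c * x) % m ≡ (c * y) % m
  %-congʳ-* c {x} {y} eq = begin
    (c * x) % m             ≡⟨ %-distribˡ-* c x m ⟩
    (c % m * (x % m)) % m   ≡⟨ cong (λ t → (c % m * t) % m) eq ⟩
    (c % m * (y % m)) % m   ≡⟨ %-distribˡ-* c y m ⟨
    (c * y) % m             ∎
    where open ≡-Reasoning

  [m*g]%m≡0 : ∀ g → (m * g) % m ≡ 0
  [m*g]%m≡0 g = trans (cong (_% m) (*-comm m g)) (m*n%n≡0 g m)

  m*s≤n⇒s≤n/m : ∀ s n → m * s ≤ n → s ≤ n / m
  m*s≤n⇒s≤n/m s n le = subst (_≤ n / m) (m*n/n≡m s m) (/-monoˡ-≤ m (subst (_≤ n) (*-comm m s) le))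

  s≤n/m⇒m*s≤n : ∀ s n → s ≤ n / m → m * s ≤ n
  s≤n/m⇒m*s≤n s n le = subst (_≤ n) (*-comm s m) (≤-trans (*-monoˡ-≤ m le) (m/n*n≤m n m))

  pM-suc : ∀ k n → pM m n (suc k) ≡ #weighted≤ k n (n / m)
  pM-suc k n = begin
    pM m n (suc k)
      ≡⟨ length-filter≡∑𝟙 (λ v → weighted m v ≟ n) (vecsUpTo (suc k) n) ⟩
    ∑[ v ∈ vecsUpTo (suc k) n ] 𝟙 (weighted m v ≟ n)
      ≡⟨ ∑-vecsUpTo-suc k n (λ v → 𝟙 (weighted m v ≟ n)) ⟩
    ∑[ v ∈ vecsUpTo k n ] ∑[ x < suc n ] 𝟙 (x + m * weighted m v ≟ n)
      ≡⟨ ∑∈-cong (vecsUpTo k n) (λ v → ∑<-𝟙+≟ (m * weighted m v) n) ⟩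
    ∑[ v ∈ vecsUpTo k n ] 𝟙 (m * weighted m v ≤? n)
      ≡⟨ ∑∈-cong (vecsUpTo k n) (λ v → 𝟙-cong (m * weighted m v ≤? n) (weighted m v ≤? n / m)
                                        (m*s≤n⇒s≤n/m _ n) (s≤n/m⇒m*s≤n _ n)) ⟩
    #weighted≤ k n (n / m) ∎
    where open ≡-Reasoning

  a∸m*s≡a%m+m*[a/m∸s] : ∀ a s → s ≤ a / m → a ∸ m * s ≡ a % m + m * (a / m ∸ s)
  a∸m*s≡a%m+m*[a/m∸s] a s s≤q = begin
    a ∸ m * s                   ≡⟨ cong (_∸ m * s) (m≡m%n+[m/n]*n a m) ⟩
    a % m + a / m * m ∸ m * s   ≡⟨ +-∸-assoc (a % m) (subst (m * s ≤_) (*-comm m (a / m)) (*-monoʳ-≤ m s≤q)) ⟩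
    a % m + (a / m * m ∸ m * s) ≡⟨ cong (λ t → a % m + (t ∸ m * s)) (*-comm (a / m) m) ⟩
    a % m + (m * (a / m) ∸ m * s) ≡⟨ cong (a % m +_) (*-distribˡ-∸ m (a / m) s) ⟨
    a % m + m * (a / m ∸ s)     ∎
    where open ≡-Reasoning

  -- A tail of weight s ≤ a / m admits a ∸ m s + 1 = (a % m + 1) + m (a / m ∸ s) first coordinates.
  #weighted≤-suc : ∀ k b a → a ≤ b →
    #weighted≤ (suc k) b a ≡
      suc (a % m) * #weighted≤ k b (a / m) +
      m * ∑[ v ∈ vecsUpTo k b ] (𝟙 (weighted m v ≤? a / m) * (a / m ∸ weighted m v))
  #weighted≤-suc k b a a≤b = begin
    #weighted≤ (suc k) b a
      ≡⟨ ∑-vecsUpTo-suc k b (λ v → 𝟙 (weighted m v ≤? a)) ⟩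
    ∑[ v ∈ V ] ∑[ x < suc b ] 𝟙 (x + m * weighted m v ≤? a)
      ≡⟨ ∑∈-cong V (λ v → ∑<-𝟙+≤ (m * weighted m v) a (suc b) (s≤s a≤b)) ⟩
    ∑[ v ∈ V ] (𝟙 (m * weighted m v ≤? a) * suc (a ∸ m * weighted m v))
      ≡⟨ ∑∈-cong V (λ v → column (weighted m v)) ⟩
    ∑[ v ∈ V ] (suc r * 𝟙 (weighted m v ≤? q) + m * (𝟙 (weighted m v ≤? q) * (q ∸ weighted m v)))
      ≡⟨ ∑∈-distrib-+ V _ _ ⟩
    ∑[ v ∈ V ] (suc r * 𝟙 (weighted m v ≤? q)) + ∑[ v ∈ V ] (m * (𝟙 (weighted m v ≤? q) * (q ∸ weighted m v)))
      ≡⟨ cong₂ _+_ (∑∈-distribˡ-* V (suc r) _) (∑∈-distribˡ-* V m _) ⟩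
    suc r * #weighted≤ k b q + m * ∑[ v ∈ V ] (𝟙 (weighted m v ≤? q) * (q ∸ weighted m v)) ∎
    where
    open ≡-Reasoning
    V : List (Vec ℕ k)
    V = vecsUpTo k b
    q r : ℕ
    q = a / m
    r = a % m
    column : ∀ s → 𝟙 (m * s ≤? a) * suc (a ∸ m * s) ≡ suc r * 𝟙 (s ≤? q) + m * (𝟙 (s ≤? q) * (q ∸ s))
    column s with s ≤? q
    ... | no s≰q = begin
      𝟙 (m * s ≤? a) * suc (a ∸ m * s)
        ≡⟨ cong (_* suc (a ∸ m * s)) (𝟙-no (m * s ≤? a) (s≰q ∘ m*s≤n⇒s≤n/m s a)) ⟩
      0                                ≡⟨ cong₂ _+_ (*-zeroʳ (suc r)) (*-zeroʳ m) ⟨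
      suc r * 0 + m * 0                ∎
    ... | yes s≤q = begin
      𝟙 (m * s ≤? a) * suc (a ∸ m * s)
        ≡⟨ cong (_* suc (a ∸ m * s)) (𝟙-yes (m * s ≤? a) (s≤n/m⇒m*s≤n s a s≤q)) ⟩
      1 * suc (a ∸ m * s)              ≡⟨ cong (λ t → 1 * suc t) (a∸m*s≡a%m+m*[a/m∸s] a s s≤q) ⟩
      1 * suc (r + m * (q ∸ s))        ≡⟨ regroup r m (q ∸ s) ⟩
      suc r * 1 + m * (1 * (q ∸ s))    ∎
      where
      regroup : ∀ r m t → 1 * suc (r + m * t) ≡ suc r * 1 + m * (1 * t)
      regroup = solve-∀

  #weighted≤-mod : ∀ k b a → a ≤ b → #weighted≤ k b a % m ≡ digitProduct k a % m
  #weighted≤-mod zero    b a a≤b = refl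
  #weighted≤-mod (suc k) b a a≤b = begin
    #weighted≤ (suc k) b a % m                      ≡⟨ cong (_% m) (#weighted≤-suc k b a a≤b) ⟩
    (suc r * #weighted≤ k b q + m * _) % m          ≡⟨ %-remove-+ʳ (suc r * #weighted≤ k b q) (m∣m*n _) ⟩
    (suc r * #weighted≤ k b q) % m                  ≡⟨ %-congʳ-* (suc r) (#weighted≤-mod k b q q≤b) ⟩
    (suc r * digitProduct k q) % m                  ≡⟨⟩
    digitProduct (suc k) a % m                      ∎
    where
    open ≡-Reasoning
    q r : ℕ
    q = a / m
    r = a % m
    q≤b : q ≤ b
    q≤b = ≤-trans (m/n≤m a m) a≤b

  pM-mod : ∀ k n → pM m n (suc k) % m ≡ digitProduct k (n / m) % m
  pM-mod k n = trans (cong (_% m) (pM-suc k n)) (#weighted≤-mod k n (n / m) (m/n≤m n m))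

  [q*m+d]%m≡d : ∀ q d → d < m → (q * m + d) % m ≡ d
  [q*m+d]%m≡d q d d<m = trans (cong (_% m) (+-comm (q * m) d)) (trans ([m+kn]%n≡m%n d q m) (m<n⇒m%n≡m d<m))

  [q*m+d]/m≡q : ∀ q d → d < m → (q * m + d) / m ≡ q
  [q*m+d]/m≡q q d d<m =
    trans (+-distrib-/-∣ˡ d (n∣m*n q)) (trans (cong₂ _+_ (m*n/n≡m q m) (m<n⇒m/n≡0 d<m)) (+-identityʳ q))

  [m^suc-j+a]/m≡m^j+a/m : ∀ j a → (m ^ suc j + a) / m ≡ m ^ j + a / m
  [m^suc-j+a]/m≡m^j+a/m j a =
    trans (+-distrib-/-∣ˡ a (m∣m*n (m ^ j))) (cong (_+ a / m) (trans (cong (_/ m) (*-comm m (m ^ j))) (m*n/n≡m (m ^ j) m)))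

  ∑<-m^suc : ∀ j (f : ℕ → ℕ) → ∑[ x < m ^ suc j ] f x ≡ ∑[ q < m ^ j ] ∑[ d < m ] f (q * m + d)
  ∑<-m^suc j f = trans (cong (λ n → ∑[ x < n ] f x) (*-comm m (m ^ j))) (∑<-blocks (m ^ j) m f)

  digitProduct-suc : ∀ j q d → d < m → digitProduct (suc j) (q * m + d) ≡ suc d * digitProduct j q
  digitProduct-suc j q d d<m = cong₂ (λ r q′ → suc r * digitProduct j q′) ([q*m+d]%m≡d q d d<m) ([q*m+d]/m≡q q d d<m)

  digitProduct-periodic : ∀ j a → digitProduct j (m ^ j + a) ≡ digitProduct j a
  digitProduct-periodic zero    a = refl
  digitProduct-periodic (suc j) a = cong₂ (λ r q → suc r * q) (%-remove-+ˡ a (m∣m*n (m ^ j)))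
    (trans (cong (digitProduct j) ([m^suc-j+a]/m≡m^j+a/m j a)) (digitProduct-periodic j (a / m)))

  residueIndicator : ℕ → ℕ → ℕ → ℕ
  residueIndicator k i n = 𝟙 (digitProduct k (n / m) % m ≟ i)

  countRes≡∑residueIndicator : ∀ k {i} → i < m → ∀ N →
                               countRes m (suc k) i N ≡ ∑[ n < suc N ] residueIndicator k i n
  countRes≡∑residueIndicator k {i} i<m N = begin
    countRes m (suc k) i N
      ≡⟨ length-filter≡∑𝟙 (λ n → pM m n (suc k) % m ≟ i % m) (upTo (suc N)) ⟩
    ∑[ n ∈ upTo (suc N) ] 𝟙 (pM m n (suc k) % m ≟ i % m)
      ≡⟨ ∑∈-applyUpTo (λ n → n) (suc N) _ ⟩
    ∑[ n < suc N ] 𝟙 (pM m n (suc k) % m ≟ i % m)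
      ≡⟨ ∑<-cong (suc N) (λ n _ → cong₂ (λ a b → 𝟙 (a ≟ b)) (pM-mod k n) (m<n⇒m%n≡m i<m)) ⟩
    ∑[ n < suc N ] residueIndicator k i n ∎
    where open ≡-Reasoning

  residueIndicator-periodic : ∀ k i n → residueIndicator k i (m ^ suc k + n) ≡ residueIndicator k i n
  residueIndicator-periodic k i n = cong (λ a → 𝟙 (a % m ≟ i))
    (trans (cong (digitProduct k) ([m^suc-j+a]/m≡m^j+a/m k n)) (digitProduct-periodic k (n / m)))

_∤?_ : ∀ d n → Dec (d ∤ n)
d ∤? n = ¬? (d ∣? n)

module _ (m : ℕ) .{{_ : NonZero m}} (m-prime : Prime m) where

  ∤⇒coprime : ∀ {g} → m ∤ g → Coprime g m
  ∤⇒coprime m∤g (d∣g , d∣m) with prime⇒irreducible m-prime d∣m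
  ... | inj₁ d≡1 = d≡1
  ... | inj₂ refl = ⊥-elim (m∤g d∣g)

  ∃-inverse-mod : ∀ {g} → m ∤ g → ∃[ e ] (e * g) % m ≡ 1 % m
  ∃-inverse-mod {g} m∤g with coprime-Bézout (∤⇒coprime m∤g)
  ... | Bézout.+- x y eq = x , (begin
    (x * g) % m      ≡⟨ cong (_% m) eq ⟨
    (1 + y * m) % m  ≡⟨ [m+kn]%n≡m%n 1 y m ⟩
    1 % m            ∎)
    where open ≡-Reasoning
  ... | Bézout.-+ x y eq = t * x , (begin
    (t * x * g) % m             ≡⟨ [m+n]%n≡m%n (t * x * g) m ⟨
    (t * x * g + m) % m         ≡⟨ cong (λ z → (t * x * g + z) % m) (m∸n+n≡m (>-nonZero⁻¹ m)) ⟨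
    (t * x * g + (t + 1)) % m   ≡⟨ cong (_% m) (regroup t x g) ⟩
    (1 + t * (1 + x * g)) % m   ≡⟨ cong (λ z → (1 + t * z) % m) eq ⟩
    (1 + t * (y * m)) % m       ≡⟨ cong (λ z → (1 + z) % m) (*-assoc t y m) ⟨
    (1 + t * y * m) % m         ≡⟨ [m+kn]%n≡m%n 1 (t * y) m ⟩
    1 % m                       ∎)
    where
    open ≡-Reasoning
    -- (m − 1)(1 + x g) ≡ 0 makes (m − 1) x g ≡ 1 − m ≡ 1.
    t : ℕ
    t = m ∸ 1
    regroup : ∀ t x g → t * x * g + (t + 1) ≡ 1 + t * (1 + x * g)
    regroup = solve-∀

  ∃-solution-mod : ∀ {g} → m ∤ g → ∀ c → ∃[ e ] e < m × (e * g) % m ≡ c % m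
  ∃-solution-mod {g} m∤g c with e , eg≡1 ← ∃-inverse-mod m∤g = (c * e) % m , m%n<n (c * e) m , (begin
    ((c * e) % m * g) % m    ≡⟨ cong (_% m) (*-comm _ g) ⟩
    (g * ((c * e) % m)) % m  ≡⟨ %-congʳ-* m g (m%n%n≡m%n (c * e) m) ⟩
    (g * (c * e)) % m        ≡⟨ cong (_% m) (regroup g c e) ⟩
    (c * (e * g)) % m        ≡⟨ %-congʳ-* m c eg≡1 ⟩
    (c * 1) % m              ≡⟨ cong (_% m) (*-identityʳ c) ⟩
    c % m                    ∎)
    where
    open ≡-Reasoning
    regroup : ∀ g c e → g * (c * e) ≡ c * (e * g)
    regroup = solve-∀

  *-cancelʳ-mod-≤ : ∀ {g u v} → m ∤ g → u ≤ v → v < m → (u * g) % m ≡ (v * g) % m → u ≡ v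
  *-cancelʳ-mod-≤ {g} {u} {v} m∤g u≤v v<m eq
    with euclidsLemma (v ∸ u) g m-prime (subst (m ∣_) (sym (*-distribʳ-∸ g v u)) (%≡⇒∣∸ m (u * g) (v * g) eq))
  ... | inj₂ m∣g = ⊥-elim (m∤g m∣g)
  ... | inj₁ m∣v∸u with v ∸ u in v∸u≡
  ...   | zero  = ≤-antisym u≤v (m∸n≡0⇒m≤n v∸u≡)
  ...   | suc _ = ⊥-elim (>⇒∤ (subst (_< m) v∸u≡ (≤-<-trans (m∸n≤m v u) v<m)) m∣v∸u)

  *-cancelʳ-mod : ∀ {g u v} → m ∤ g → u < m → v < m → (u * g) % m ≡ (v * g) % m → u ≡ v
  *-cancelʳ-mod m∤g u<m v<m eq with ≤-total _ _
  ... | inj₁ u≤v = *-cancelʳ-mod-≤ m∤g u≤v v<m eq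
  ... | inj₂ v≤u = sym (*-cancelʳ-mod-≤ m∤g v≤u u<m (sym eq))

  #[e*g≡c]≡1 : ∀ {g c} → m ∤ g → c < m → ∑[ e < m ] 𝟙 ((e * g) % m ≟ c) ≡ 1
  #[e*g≡c]≡1 {g} {c} m∤g c<m with e , e<m , eg≡c ← ∃-solution-mod m∤g c =
    ∑<-𝟙-unique m (λ x → (x * g) % m ≟ c) e<m eg≡c′
      (λ x x<m xg≡c → *-cancelʳ-mod m∤g x<m e<m (trans xg≡c (sym eg≡c′)))
    where
    eg≡c′ : (e * g) % m ≡ c
    eg≡c′ = trans eg≡c (m<n⇒m%n≡m c<m)

  -- suc d runs through 1, …, m, again a complete system of residues.
  #[suc-d*g≡i] : ∀ {i} → 1 ≤ i → i < m → ∀ g → ∑[ d < m ] 𝟙 ((suc d * g) % m ≟ i) ≡ 𝟙 (m ∤? g)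
  #[suc-d*g≡i] {i} 1≤i i<m g = trans (∑<-rotate m hit wraps) (count (m ∣? g))
    where
    hit : ℕ → ℕ
    hit e = 𝟙 ((e * g) % m ≟ i)
    wraps : hit m ≡ hit 0
    wraps = cong (λ r → 𝟙 (r ≟ i)) (trans ([m*g]%m≡0 m g) (sym (m*n%n≡0 0 m)))
    count : (m∣?g : Dec (m ∣ g)) → ∑[ e < m ] 𝟙 ((e * g) % m ≟ i) ≡ 𝟙 (¬? m∣?g)
    count (yes m∣g) = ∑<-zero m (λ e _ → 𝟙-no ((e * g) % m ≟ i)
                        (λ eg≡i → <⇒≢ 1≤i (trans (sym (n∣m⇒m%n≡0 _ m (∣n⇒∣m*n e m∣g))) eg≡i)))
    count (no m∤g)  = #[e*g≡c]≡1 m∤g i<m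

  #[m∤suc-d*g] : ∀ g → ∑[ d < m ] 𝟙 (m ∤? (suc d * g)) ≡ (m ∸ 1) * 𝟙 (m ∤? g)
  #[m∤suc-d*g] g = trans (∑<-rotate m coprime wraps) (count (m ∣? g))
    where
    coprime : ℕ → ℕ
    coprime e = 𝟙 (m ∤? (e * g))
    wraps : coprime m ≡ coprime 0
    wraps = 𝟙-cong (m ∤? (m * g)) (m ∤? 0) (λ m∤mg _ → m∤mg (m∣m*n g)) (λ m∤0 _ → m∤0 (m ∣0))
    count : (m∣?g : Dec (m ∣ g)) → ∑[ e < m ] 𝟙 (m ∤? (e * g)) ≡ (m ∸ 1) * 𝟙 (¬? m∣?g)
    count (yes m∣g) = trans (∑<-zero m (λ e _ → 𝟙-no (m ∤? (e * g)) (λ m∤eg → m∤eg (∣n⇒∣m*n e m∣g))))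
                            (sym (*-zeroʳ (m ∸ 1)))
    count (no m∤g)  = begin
      ∑[ e < m ] 𝟙 (m ∤? (e * g))          ≡⟨ ∑<-𝟙-¬? m (λ e → m ∣? (e * g)) ⟩
      m ∸ ∑[ e < m ] 𝟙 (m ∣? (e * g))
        ≡⟨ cong (m ∸_) (∑<-cong m (λ e _ → 𝟙-cong (m ∣? (e * g)) ((e * g) % m ≟ 0) (n∣m⇒m%n≡0 _ m) (m%n≡0⇒n∣m _ m))) ⟩
      m ∸ ∑[ e < m ] 𝟙 ((e * g) % m ≟ 0)   ≡⟨ cong (m ∸_) (#[e*g≡c]≡1 m∤g (>-nonZero⁻¹ m)) ⟩
      m ∸ 1                                ≡⟨ *-identityʳ (m ∸ 1) ⟨
      (m ∸ 1) * 1                          ∎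
      where open ≡-Reasoning

  m∤1 : m ∤ 1
  m∤1 = >⇒∤ (nonTrivial⇒n>1 m {{prime⇒nonTrivial m-prime}})

  #[m∤digitProduct] : ∀ j → ∑[ a < m ^ j ] 𝟙 (m ∤? digitProduct m j a) ≡ (m ∸ 1) ^ j
  #[m∤digitProduct] zero    = cong (_+ 0) (𝟙-yes (m ∤? 1) m∤1)
  #[m∤digitProduct] (suc j) = begin
    ∑[ a < m ^ suc j ] 𝟙 (m ∤? digitProduct m (suc j) a)
      ≡⟨ ∑<-m^suc m j _ ⟩
    ∑[ q < m ^ j ] ∑[ d < m ] 𝟙 (m ∤? digitProduct m (suc j) (q * m + d))
      ≡⟨ ∑<-cong (m ^ j) (λ q _ → ∑<-cong m (λ d d<m → cong (λ z → 𝟙 (m ∤? z)) (digitProduct-suc m j q d d<m))) ⟩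
    ∑[ q < m ^ j ] ∑[ d < m ] 𝟙 (m ∤? (suc d * digitProduct m j q))
      ≡⟨ ∑<-cong (m ^ j) (λ q _ → #[m∤suc-d*g] (digitProduct m j q)) ⟩
    ∑[ q < m ^ j ] ((m ∸ 1) * 𝟙 (m ∤? digitProduct m j q))
      ≡⟨ ∑<-distribˡ-* (m ^ j) (m ∸ 1) _ ⟩
    (m ∸ 1) * ∑[ q < m ^ j ] 𝟙 (m ∤? digitProduct m j q)
      ≡⟨ cong ((m ∸ 1) *_) (#[m∤digitProduct] j) ⟩
    (m ∸ 1) ^ suc j ∎
    where open ≡-Reasoning

  #[digitProduct≡i] : ∀ {i} → 1 ≤ i → i < m → ∀ j →
                      ∑[ a < m ^ suc j ] 𝟙 (digitProduct m (suc j) a % m ≟ i) ≡ (m ∸ 1) ^ j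
  #[digitProduct≡i] {i} 1≤i i<m j = begin
    ∑[ a < m ^ suc j ] 𝟙 (digitProduct m (suc j) a % m ≟ i)
      ≡⟨ ∑<-m^suc m j _ ⟩
    ∑[ q < m ^ j ] ∑[ d < m ] 𝟙 (digitProduct m (suc j) (q * m + d) % m ≟ i)
      ≡⟨ ∑<-cong (m ^ j) (λ q _ → ∑<-cong m (λ d d<m → cong (λ z → 𝟙 (z % m ≟ i)) (digitProduct-suc m j q d d<m))) ⟩
    ∑[ q < m ^ j ] ∑[ d < m ] 𝟙 ((suc d * digitProduct m j q) % m ≟ i)
      ≡⟨ ∑<-cong (m ^ j) (λ q _ → #[suc-d*g≡i] 1≤i i<m (digitProduct m j q)) ⟩
    ∑[ q < m ^ j ] 𝟙 (m ∤? digitProduct m j q)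
      ≡⟨ #[m∤digitProduct] j ⟩
    (m ∸ 1) ^ j ∎
    where open ≡-Reasoning

  ∑residueIndicator-period : ∀ {i} → 1 ≤ i → i < m → ∀ j →
    ∑[ n < m ^ suc (suc j) ] residueIndicator m (suc j) i n ≡ m * (m ∸ 1) ^ j
  ∑residueIndicator-period {i} 1≤i i<m j = begin
    ∑[ n < m ^ suc (suc j) ] residueIndicator m (suc j) i n
      ≡⟨ ∑<-m^suc m (suc j) _ ⟩
    ∑[ q < m ^ suc j ] ∑[ d < m ] 𝟙 (digitProduct m (suc j) ((q * m + d) / m) % m ≟ i)
      ≡⟨ ∑<-cong (m ^ suc j) (λ q _ → ∑<-cong m (λ d d<m →
           cong (λ a → 𝟙 (digitProduct m (suc j) a % m ≟ i)) ([q*m+d]/m≡q m q d d<m))) ⟩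
    ∑[ q < m ^ suc j ] ∑[ d < m ] 𝟙 (digitProduct m (suc j) q % m ≟ i)
      ≡⟨ ∑<-cong (m ^ suc j) (λ q _ → ∑<-const m _) ⟩
    ∑[ q < m ^ suc j ] (m * 𝟙 (digitProduct m (suc j) q % m ≟ i))
      ≡⟨ ∑<-distribˡ-* (m ^ suc j) m _ ⟩
    m * ∑[ q < m ^ suc j ] 𝟙 (digitProduct m (suc j) q % m ≟ i)
      ≡⟨ cong (m *_) (#[digitProduct≡i] 1≤i i<m j) ⟩
    m * (m ∸ 1) ^ j ∎
    where open ≡-Reasoning

∣⊖∣≤ : ∀ {a b c} → a ≤ b + c → b ≤ a + c → ℤ.∣ a ⊖ b ∣ ≤ c
∣⊖∣≤ {a} {b} a≤b+c b≤a+c with ≤-total a b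
... | inj₁ a≤b = subst (_≤ _) (sym (ℤP.∣⊖∣-≤ a≤b)) (m≤n+o⇒m∸n≤o b a b≤a+c)
... | inj₂ b≤a = subst (_≤ _) (sym (trans (ℤP.∣m⊖n∣≡∣n⊖m∣ a b) (ℤP.∣⊖∣-≤ b≤a))) (m≤n+o⇒m∸n≤o a b a≤b+c)

+c*+d-+a*+n≡c*d⊖a*n : ∀ c d a n → ℤ.+ c ℤ.* ℤ.+ d ℤ.+ ℤ.- (ℤ.+ a) ℤ.* ℤ.+ n ≡ c * d ⊖ a * n
+c*+d-+a*+n≡c*d⊖a*n c d a n = begin
  ℤ.+ c ℤ.* ℤ.+ d ℤ.+ ℤ.- (ℤ.+ a) ℤ.* ℤ.+ n    ≡⟨ cong₂ ℤ._+_ (ℤP.pos-* c d) (ℤP.neg-distribˡ-* (ℤ.+ a) (ℤ.+ n)) ⟨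
  ℤ.+ (c * d) ℤ.+ ℤ.- (ℤ.+ a ℤ.* ℤ.+ n)      ≡⟨ cong (λ z → ℤ.+ (c * d) ℤ.+ ℤ.- z) (ℤP.pos-* a n) ⟨
  ℤ.+ (c * d) ℤ.+ ℤ.- (ℤ.+ (a * n))        ≡⟨ ℤP.m-n≡m⊖n (c * d) (a * n) ⟩
  c * d ⊖ a * n                        ∎
  where open ≡-Reasoning

toℚᵘ-∣/ℕ-/ℕ∣ : ∀ c a n d →
  toℚᵘ ∣ c /ℕ suc n - a /ℕ suc d ∣ ℚᵘ.≃ (ℤ.+ ℤ.∣ c * suc d ⊖ a * suc n ∣) ℚᵘ./ (suc n * suc d)
toℚᵘ-∣/ℕ-/ℕ∣ c a n d =
  ℚᵘP.≃-trans (ℚP.toℚᵘ-homo-∣-∣ (x - y))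
    (ℚᵘP.≃-trans (ℚᵘP.∣-∣-cong difference)
      (ℚᵘP.≃-reflexive (cong (λ z → mkℚᵘ (ℤ.+ ℤ.∣ z ∣) _) (+c*+d-+a*+n≡c*d⊖a*n c (suc d) a (suc n)))))
  where
  x y : ℚ
  x = ℤ.+ c ℚ./ suc n
  y = ℤ.+ a ℚ./ suc d
  difference : toℚᵘ (x - y) ℚᵘ.≃ mkℚᵘ (ℤ.+ c) n ℚᵘ.+ ℚᵘ.- mkℚᵘ (ℤ.+ a) d
  difference = ℚᵘP.≃-trans (ℚP.toℚᵘ-homo-+ x (ℚ.- y))
    (ℚᵘP.+-cong (ℚP.toℚᵘ-fromℚᵘ (mkℚᵘ (ℤ.+ c) n))
                (ℚᵘP.≃-trans (ℚP.toℚᵘ-homo‿- y) (ℚᵘP.-‿cong (ℚP.toℚᵘ-fromℚᵘ (mkℚᵘ (ℤ.+ a) d)))))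

-- For ε = (p + 1)/(q + 1): ∣c/N − A/D∣ = ∣cD − AN∣/(ND) ≤ B/N < ε as soon as N > B (q + 1).
eventually-∣c/N-A/D∣<ε : ∀ A D B → 0 < D → ∀ ε → 0ℚ <ℚ ε → ∃[ N₀ ] (∀ N → N₀ ≤ N → ∀ c →
  c * D ≤ A * N + B → A * N ≤ c * D + B → ∣ c /ℕ N - A /ℕ D ∣ <ℚ ε)
eventually-∣c/N-A/D∣<ε A (suc d) B _ (mkℚ (ℤ.+ zero)   _ _) (ℚ.*<* (ℤ.+<+ ()))
eventually-∣c/N-A/D∣<ε A (suc d) B _ (mkℚ -[1+ _ ]   _ _) (ℚ.*<* ())
eventually-∣c/N-A/D∣<ε A (suc d) B _ (mkℚ +[1+ p ] q _) _ = suc (B * suc q) , close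
  where
  close : ∀ N → suc (B * suc q) ≤ N → ∀ c → c * suc d ≤ A * N + B → A * N ≤ c * suc d + B →
          ∣ c /ℕ N - A /ℕ suc d ∣ <ℚ mkℚ +[1+ p ] q _
  close (suc n) (s≤s B[1+q]≤n) c c≤ ≤c =
    ℚP.toℚᵘ-cancel-< (ℚᵘP.<-respˡ-≃ (ℚᵘP.≃-sym (toℚᵘ-∣/ℕ-/ℕ∣ c A n d))
      (ℚᵘ.*<* (subst₂ ℤ._<_ (ℤP.pos-* ℤ.∣ c * suc d ⊖ A * suc n ∣ (suc q)) (ℤP.pos-* (suc p) (suc n * suc d))
                          (ℤ.+<+ small))))
    where
    small : ℤ.∣ c * suc d ⊖ A * suc n ∣ * suc q < suc p * (suc n * suc d)
    small = begin-strict
      ℤ.∣ c * suc d ⊖ A * suc n ∣ * suc q ≤⟨ *-monoˡ-≤ (suc q) (∣⊖∣≤ c≤ ≤c) ⟩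
      B * suc q                           <⟨ s≤s B[1+q]≤n ⟩
      suc n                               ≤⟨ m≤m*n (suc n) (suc d) ⟩
      suc n * suc d                       ≤⟨ m≤n*m (suc n * suc d) (suc p) ⟩
      suc p * (suc n * suc d)             ∎
      where open ≤-Reasoning

countRes-bounds : ∀ m .{{_ : NonZero m}} → Prime m → ∀ {i} → 1 ≤ i → i < m → ∀ j → ∃[ B ] ∀ N →
  countRes m (suc (suc j)) i N * m ^ suc j ≤ (m ∸ 1) ^ j * N + B ×
  (m ∸ 1) ^ j * N ≤ countRes m (suc (suc j)) i N * m ^ suc j + B
countRes-bounds m m-prime {i} 1≤i i<m j = C + (C + D) * P , λ N →
  subst (λ c → c * D ≤ C * N + _ × C * N ≤ c * D + _) (sym (countRes≡∑residueIndicator m (suc j) i<m N))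
        (to-N (∑<-periodic-density P f (λ n → 𝟙≤1 _) (residueIndicator-periodic m (suc j) i) C D density (suc N)))
  where
  C D P : ℕ
  C = (m ∸ 1) ^ j
  D = m ^ suc j
  P = m ^ suc (suc j)
  instance
    P≢0 : NonZero P
    P≢0 = m^n≢0 m (suc (suc j))
  f : ℕ → ℕ
  f = residueIndicator m (suc j) i
  density : ∑[ n < P ] f n * D ≡ C * P
  density = trans (cong (_* D) (∑residueIndicator-period m m-prime 1≤i i<m j)) (regroup m C D)
    where
    regroup : ∀ m C D → m * C * D ≡ C * (m * D)
    regroup = solve-∀
  -- countRes counts n = 0, …, N, that is N + 1 values.
  to-N : ∀ {N c X} → c ≤ C * suc N + X × C * suc N ≤ c + X → c ≤ C * N + (C + X) × C * N ≤ c + (C + X)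
  to-N {N} {c} {X} (c≤ , ≤c) =
    subst (c ≤_) (regroup C N X) c≤ ,
    ≤-trans (*-monoʳ-≤ C (n≤1+n N)) (≤-trans ≤c (+-monoʳ-≤ c (m≤n+m X C)))
    where
    regroup : ∀ C N X → C * suc N + X ≡ C * N + (C + X)
    regroup = solve-∀

corollary6p4 : (m i k : ℕ) → .{{_ : NonZero m}} → Prime m → 1 ≤ i → i < m → 2 ≤ k →
    (ε : ℚ) → 0ℚ <ℚ ε → ∃[ N₀ ] ((N : ℕ) → N₀ ≤ N →
      ∣ (countRes m k i N /ℕ N) - (((m ∸ 1) ^ (k ∸ 2)) /ℕ (m ^ (k ∸ 1))) ∣ <ℚ ε)
corollary6p4 m i (suc (suc j)) m-prime 1≤i i<m (s≤s (s≤s _)) ε 0<ε =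
  let B , bounds = countRes-bounds m m-prime 1≤i i<m j
      N₀ , close = eventually-∣c/N-A/D∣<ε ((m ∸ 1) ^ j) (m ^ suc j) B (m^n>0 m (suc j)) ε 0<ε
  in  N₀ , λ N N₀≤N → close N N₀≤N (countRes m (suc (suc j)) i N) (proj₁ (bounds N)) (proj₂ (bounds N))
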